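{- Let $k$ be an odd positive integer. For every integer $n>0$, let $b=\lfloor \log_2 n\rfloor$ and $c=n+1-2^{b}$. Then $$d_k(n)=\frac{(2^b+c)^k+(2^b-c)^k-(2^b+c-1)^k-(2^b-c+1)^k}{2^{b+1}}.$$
   Context: A P-position of the game of Nim with $k$ piles is a $k$-tuple $(p_1,\dots,p_k)$ of non-negative integers whose nim-sum $p_1\oplus\cdots\oplus p_k$ is $0$, where $\oplus$ denotes bitwise XOR. $d_k(n)$ denotes the number of P-positions with $k$ piles whose largest pile has exactly $n$ counters. -}

module Defs where

open import Data.Nat using (ℕ; zero; suc; _+_; _*_; _⊔_; _≡ᵇ_)
open import Data.Nat.DivMod using (_%_; _/_)
open import Data.Bool using (Bool; _∧_)
open import Data.List using (List; []; _∷_; map; concatMap; upTo; length; filterᵇ)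
open import Data.Vec using (Vec; []; _∷_; foldr)

-- Bitwise XOR on ℕ, computed bit by bit with fuel.
-- The fuel a + b is always sufficient (each step halves both arguments).
xorF : ℕ → ℕ → ℕ → ℕ
xorF zero    a b = 0
xorF (suc f) a b = ((a % 2 + b % 2) % 2) + 2 * xorF f (a / 2) (b / 2)

_⊕_ : ℕ → ℕ → ℕ
a ⊕ b = xorF (a + b) a b

nimSum : ∀ {k} → Vec ℕ k → ℕ
nimSum = foldr _ _⊕_ 0

maxPile : ∀ {k} → Vec ℕ k → ℕ
maxPile = foldr _ _⊔_ 0

tuplesUpTo : (k n : ℕ) → List (Vec ℕ k)
tuplesUpTo zero    n = [] ∷ []
tuplesUpTo (suc k) n = concatMap (λ x → map (x ∷_) (tuplesUpTo k n)) (upTo (suc n))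

-- d k n : number of P-positions of k-pile Nim (nim-sum 0) whose largest pile is exactly n.
-- Any tuple with largest pile n has all entries in {0,…,n}, so enumerating
-- tuplesUpTo k n counts all of them.
d : ℕ → ℕ → ℕ
d k n = length (filterᵇ (λ v → (nimSum v ≡ᵇ 0) ∧ (maxPile v ≡ᵇ n)) (tuplesUpTo k n))

-- A P-position with largest pile n is a zero-xor k-tuple over [0, n + 1) that is not a tuple over
-- [0, n), so d_k(n) is a difference of two counts of zero-xor tuples over ranges [0, N + c) with
-- N = 2^b and c ≤ N.  Call an entry low if it is below N and high otherwise (N + y with y < c);
-- the top bit of the xor is the parity of the number of high entries.  Counting j-tuples by this
-- top bit gives two totals that evolve by the matrix [[N, c], [c, N]], whose eigenvalues N ± c
-- produce the powers (N + c)^j and (N − c)^j.  For odd k a tuple with an even number of high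
-- entries has a low entry, which can be chosen freely, so the lower b bits of its xor are uniformly
-- distributed; hence N times the number of zero-xor tuples is the number of tuples with top bit 0,
-- namely ((N + c)^k + (N − c)^k) / 2.

module Submission where

open import Defs

module _ where

  open import Data.Bool using (Bool; true; false; not; T; _∧_; if_then_else_)
  open import Data.Bool.Properties using (∧-identityʳ; not-involutive)
  open import Data.Empty using (⊥-elim)
  open import Data.List using (List; []; _∷_; _++_; map; concatMap; upTo; length; filterᵇ)
  open import Data.List.Properties using (upTo-∷ʳ; length-++; filter-++; map-++; map-cong)
  open import Data.Unit using (tt)
  open import Data.Vec using (Vec; []; _∷_)
  open import Data.Vec.Relation.Unary.All using (All; []; _∷_)
  open import Data.Nat
  open import Data.Nat.Properties
  open import Data.Nat.DivMod
  open import Data.Nat.ListAction using (sum)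
  open import Data.Nat.ListAction.Properties using (sum-++)
  open import Data.Nat.Divisibility using (n∣m*n)
  open import Data.Nat.Logarithm
  open import Data.Nat.Tactic.RingSolver using (solve-∀)
  open import Data.Sum using (inj₁; inj₂)
  open import Relation.Nullary using (yes; no)
  open import Function using (_∘_)
  open import Relation.Binary.PropositionalEquality

  -- Finite sums

  ∑ : ℕ → (ℕ → ℕ) → ℕ
  ∑ zero    f = 0
  ∑ (suc n) f = ∑ n f + f n

  syntax ∑ n (λ x → e) = ∑[ x < n ] e

  ∑-cong : ∀ n {f g : ℕ → ℕ} → (∀ {x} → x < n → f x ≡ g x) → ∑ n f ≡ ∑ n g
  ∑-cong zero    eq = refl
  ∑-cong (suc n) eq = cong₂ _+_ (∑-cong n (eq ∘ m<n⇒m<1+n)) (eq (n<1+n n))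

  ∑-distrib-+ : ∀ n (f g : ℕ → ℕ) → ∑[ x < n ] (f x + g x) ≡ ∑ n f + ∑ n g
  ∑-distrib-+ zero    f g = refl
  ∑-distrib-+ (suc n) f g rewrite ∑-distrib-+ n f g = interchange (∑ n f) (∑ n g) (f n) (g n)
    where
    interchange : ∀ a b c d → (a + b) + (c + d) ≡ (a + c) + (b + d)
    interchange = solve-∀

  ∑-distribˡ-* : ∀ n c (f : ℕ → ℕ) → ∑[ x < n ] (c * f x) ≡ c * ∑ n f
  ∑-distribˡ-* zero    c f = sym (*-zeroʳ c)
  ∑-distribˡ-* (suc n) c f rewrite ∑-distribˡ-* n c f = sym (*-distribˡ-+ c (∑ n f) (f n))

  ∑-const : ∀ n c → ∑[ _ < n ] c ≡ n * c
  ∑-const zero    c = refl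
  ∑-const (suc n) c rewrite ∑-const n c = +-comm (n * c) c

  ∑-+ : ∀ m n (f : ℕ → ℕ) → ∑ (m + n) f ≡ ∑ m f + ∑[ y < n ] f (m + y)
  ∑-+ m zero    f rewrite +-identityʳ m = sym (+-identityʳ (∑ m f))
  ∑-+ m (suc n) f rewrite +-suc m n | ∑-+ m n f = +-assoc (∑ m f) _ _

  ∑-comm : ∀ m n (g : ℕ → ℕ → ℕ) → ∑[ x < m ] ∑[ y < n ] g x y ≡ ∑[ y < n ] ∑[ x < m ] g x y
  ∑-comm zero    n g = sym (trans (∑-const n 0) (*-zeroʳ n))
  ∑-comm (suc m) n g rewrite ∑-comm m n g = sym (∑-distrib-+ n (λ y → ∑[ x < m ] g x y) (g m))

  ∑-even-odd : ∀ n (f : ℕ → ℕ) → ∑ (2 * n) f ≡ ∑[ l < n ] (f (2 * l) + f (1 + 2 * l))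
  ∑-even-odd zero    f = refl
  ∑-even-odd (suc n) f rewrite sym (∑-even-odd n f) | +-suc n (n + 0) = +-assoc (∑ (2 * n) f) _ _

  -- Binary digits and bitwise xor

  n≡n%2+2*[n/2] : ∀ n → n ≡ n % 2 + 2 * (n / 2)
  n≡n%2+2*[n/2] n = trans (m≡m%n+[m/n]*n n 2) (cong (n % 2 +_) (*-comm (n / 2) 2))

  [r+2*q]%2≡r : ∀ r q → r < 2 → (r + 2 * q) % 2 ≡ r
  [r+2*q]%2≡r r q r<2 = trans (cong (λ z → (r + z) % 2) (*-comm 2 q))
    (trans ([m+kn]%n≡m%n r q 2) (m<n⇒m%n≡m r<2))

  [r+2*q]/2≡q : ∀ r q → r < 2 → (r + 2 * q) / 2 ≡ q
  [r+2*q]/2≡q r q r<2 = trans (cong (λ z → (r + z) / 2) (*-comm 2 q))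
    (trans (+-distrib-/-∣ʳ r (n∣m*n q)) (cong₂ _+_ (m<n⇒m/n≡0 r<2) (m*n/n≡m q 2)))

  n%2<2 : ∀ n → n % 2 < 2
  n%2<2 n = m%n<n n 2

  n<2^suc⇒n/2<2^ : ∀ {n} f → n < 2 ^ suc f → n / 2 < 2 ^ f
  n<2^suc⇒n/2<2^ {n} f lt = m<n*o⇒m/o<n (subst (n <_) (*-comm 2 (2 ^ f)) lt)

  m*[2*p]+n≡n%2+2*[m*p+n/2] : ∀ m p n → m * (2 * p) + n ≡ n % 2 + 2 * (m * p + n / 2)
  m*[2*p]+n≡n%2+2*[m*p+n/2] m p n =
    trans (cong (m * (2 * p) +_) (n≡n%2+2*[n/2] n)) (regroup m p (n % 2) (n / 2))
    where
    regroup : ∀ m p r q → m * (2 * p) + (r + 2 * q) ≡ r + 2 * (m * p + q)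
    regroup = solve-∀

  [m*[2*p]+n]%2≡n%2 : ∀ m p n → (m * (2 * p) + n) % 2 ≡ n % 2
  [m*[2*p]+n]%2≡n%2 m p n = trans (cong (_% 2) (m*[2*p]+n≡n%2+2*[m*p+n/2] m p n))
    ([r+2*q]%2≡r (n % 2) (m * p + n / 2) (n%2<2 n))

  [m*[2*p]+n]/2≡m*p+n/2 : ∀ m p n → (m * (2 * p) + n) / 2 ≡ m * p + n / 2
  [m*[2*p]+n]/2≡m*p+n/2 m p n = trans (cong (_/ 2) (m*[2*p]+n≡n%2+2*[m*p+n/2] m p n))
    ([r+2*q]/2≡q (n % 2) (m * p + n / 2) (n%2<2 n))

  [p+[p+q]%2]%2≡q : ∀ p q → p < 2 → q < 2 → (p + (p + q) % 2) % 2 ≡ q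
  [p+[p+q]%2]%2≡q 0 0 _ _ = refl
  [p+[p+q]%2]%2≡q 0 1 _ _ = refl
  [p+[p+q]%2]%2≡q 1 0 _ _ = refl
  [p+[p+q]%2]%2≡q 1 1 _ _ = refl
  [p+[p+q]%2]%2≡q (suc (suc _)) _ (s≤s (s≤s ())) _
  [p+[p+q]%2]%2≡q _ (suc (suc _)) _ (s≤s (s≤s ()))

  n<2^n : ∀ n → n < 2 ^ n
  n<2^n zero    = s≤s z≤n
  n<2^n (suc n) = subst (suc (suc n) ≤_) (cong (2 ^ n +_) (sym (+-identityʳ (2 ^ n))))
    (+-mono-≤ (m^n>0 2 n) (n<2^n n))

  xorF-zero : ∀ f → xorF f 0 0 ≡ 0
  xorF-zero zero    = refl
  xorF-zero (suc f) rewrite xorF-zero f = refl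

  xorF-< : ∀ f a b → xorF f a b < 2 ^ f
  xorF-< zero    a b = s≤s z≤n
  xorF-< (suc f) a b = begin-strict
    r + 2 * z  <⟨ +-monoˡ-< (2 * z) (n%2<2 (a % 2 + b % 2)) ⟩
    2 + 2 * z  ≡⟨ sym (*-suc 2 z) ⟩
    2 * suc z  ≤⟨ *-monoʳ-≤ 2 (xorF-< f (a / 2) (b / 2)) ⟩
    2 * 2 ^ f  ∎
    where
    open ≤-Reasoning
    r = (a % 2 + b % 2) % 2
    z = xorF f (a / 2) (b / 2)

  xorF-fuel : ∀ {f g} a b → g ≤ f → a < 2 ^ g → b < 2 ^ g → xorF f a b ≡ xorF g a b
  xorF-fuel {f}     {zero}  .0 .0 _ (s≤s z≤n) (s≤s z≤n) = xorF-zero f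
  xorF-fuel {suc f} {suc g} a b (s≤s g≤f) a< b< = cong (λ z → (a % 2 + b % 2) % 2 + 2 * z)
    (xorF-fuel (a / 2) (b / 2) g≤f (n<2^suc⇒n/2<2^ g a<) (n<2^suc⇒n/2<2^ g b<))

  ⊕≡xorF : ∀ f {a b} → a < 2 ^ f → b < 2 ^ f → a ⊕ b ≡ xorF f a b
  ⊕≡xorF f {a} {b} a< b< with ≤-total f (a + b)
  ... | inj₁ f≤a+b = xorF-fuel a b f≤a+b a< b<
  ... | inj₂ a+b≤f = sym (xorF-fuel a b a+b≤f
    (<-≤-trans (n<2^n a) (^-monoʳ-≤ 2 (m≤m+n a b)))
    (<-≤-trans (n<2^n b) (^-monoʳ-≤ 2 (m≤n+m b a))))

  xorF-comm : ∀ f a b → xorF f a b ≡ xorF f b a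
  xorF-comm zero    a b = refl
  xorF-comm (suc f) a b rewrite +-comm (a % 2) (b % 2) | xorF-comm f (a / 2) (b / 2) = refl

  xorF-involutive : ∀ f x {a} → a < 2 ^ f → xorF f x (xorF f x a) ≡ a
  xorF-involutive zero    x (s≤s z≤n) = refl
  xorF-involutive (suc f) x {a} a<
    rewrite [r+2*q]%2≡r ((x % 2 + a % 2) % 2) (xorF f (x / 2) (a / 2)) (n%2<2 (x % 2 + a % 2))
          | [r+2*q]/2≡q ((x % 2 + a % 2) % 2) (xorF f (x / 2) (a / 2)) (n%2<2 (x % 2 + a % 2))
          | xorF-involutive f (x / 2) (n<2^suc⇒n/2<2^ f a<)
          | [p+[p+q]%2]%2≡q (x % 2) (a % 2) (n%2<2 x) (n%2<2 a)
    = sym (n≡n%2+2*[n/2] a)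

  xorF-highBit : ∀ b h h' {x y} → x < 2 ^ b → y < 2 ^ b →
    xorF (suc b) (h * 2 ^ b + x) (h' * 2 ^ b + y) ≡ (h + h') % 2 * 2 ^ b + xorF b x y
  xorF-highBit zero h h' (s≤s z≤n) (s≤s z≤n)
    rewrite *-identityʳ h | *-identityʳ h' | +-identityʳ h | +-identityʳ h' | *-identityʳ ((h + h') % 2)
    = cong (_+ 0) (sym (%-distribˡ-+ h h' 2))
  xorF-highBit (suc b) h h' {x} {y} x< y<
    rewrite [m*[2*p]+n]%2≡n%2 h (2 ^ b) x | [m*[2*p]+n]%2≡n%2 h' (2 ^ b) y
          | [m*[2*p]+n]/2≡m*p+n/2 h (2 ^ b) x | [m*[2*p]+n]/2≡m*p+n/2 h' (2 ^ b) y
          | xorF-highBit b h h' (n<2^suc⇒n/2<2^ b x<) (n<2^suc⇒n/2<2^ b y<)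
    = regroup ((h + h') % 2) (2 ^ b) ((x % 2 + y % 2) % 2) (xorF b (x / 2) (y / 2))
    where
    regroup : ∀ m p r q → r + 2 * (m * p + q) ≡ m * (2 * p) + (r + 2 * q)
    regroup = solve-∀

  ∑-xorF : ∀ b y (g : ℕ → ℕ) → ∑[ l < 2 ^ b ] g (xorF b y l) ≡ ∑ (2 ^ b) g
  ∑-xorF zero    y g = refl
  ∑-xorF (suc b) y g = begin
    ∑[ l < 2 ^ suc b ] g (xorF (suc b) y l)                            ≡⟨ ∑-even-odd (2 ^ b) _ ⟩
    ∑[ l < 2 ^ b ] (g (xorF (suc b) y (2 * l)) + g (xorF (suc b) y (1 + 2 * l)))
                                                                       ≡⟨ ∑-cong (2 ^ b) (λ {l} _ → pair l) ⟩
    ∑[ l < 2 ^ b ] g₂ (xorF b (y / 2) l)                               ≡⟨ ∑-xorF b (y / 2) g₂ ⟩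
    ∑ (2 ^ b) g₂                                                       ≡⟨ ∑-even-odd (2 ^ b) g ⟨
    ∑ (2 ^ suc b) g                                                    ∎
    where
    open ≡-Reasoning
    g₂ : ℕ → ℕ
    g₂ z = g (2 * z) + g (1 + 2 * z)
    pair : ∀ l → g (xorF (suc b) y (2 * l)) + g (xorF (suc b) y (1 + 2 * l)) ≡ g₂ (xorF b (y / 2) l)
    pair l rewrite [r+2*q]%2≡r 0 l (s≤s z≤n) | [r+2*q]/2≡q 0 l (s≤s z≤n)
                 | [r+2*q]%2≡r 1 l (s≤s (s≤s z≤n)) | [r+2*q]/2≡q 1 l (s≤s (s≤s z≤n))
                 with y % 2 | n%2<2 y
    ... | 0 | _ = refl
    ... | 1 | _ = +-comm (g (1 + 2 * xorF b (y / 2) l)) (g (2 * xorF b (y / 2) l))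
    ... | suc (suc _) | s≤s (s≤s ())

  -- Counting tuples

  module _ {A : Set} (q : A → Bool) where

    length-filterᵇ-concatMap : ∀ {B : Set} (g : B → List A) xs →
      length (filterᵇ q (concatMap g xs)) ≡ sum (map (λ x → length (filterᵇ q (g x))) xs)
    length-filterᵇ-concatMap g []       = refl
    length-filterᵇ-concatMap g (x ∷ xs) = begin
      length (filterᵇ q (g x ++ concatMap g xs))                 ≡⟨ cong length (filter-++ _ (g x) _) ⟩
      length (filterᵇ q (g x) ++ filterᵇ q (concatMap g xs))     ≡⟨ length-++ (filterᵇ q (g x)) ⟩
      length (filterᵇ q (g x)) + length (filterᵇ q (concatMap g xs))
                                                                 ≡⟨ cong (_ +_) (length-filterᵇ-concatMap g xs) ⟩
      sum (map (λ x → length (filterᵇ q (g x))) (x ∷ xs))        ∎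
      where open ≡-Reasoning

    length-filterᵇ-map : ∀ {B : Set} (g : B → A) xs →
      length (filterᵇ q (map g xs)) ≡ length (filterᵇ (q ∘ g) xs)
    length-filterᵇ-map g []       = refl
    length-filterᵇ-map g (x ∷ xs) with q (g x)
    ... | true  = cong suc (length-filterᵇ-map g xs)
    ... | false = length-filterᵇ-map g xs

  sum-map-upTo : ∀ n (f : ℕ → ℕ) → sum (map f (upTo n)) ≡ ∑ n f
  sum-map-upTo zero    f = refl
  sum-map-upTo (suc n) f = begin
    sum (map f (upTo (suc n)))           ≡⟨ cong (sum ∘ map f) (upTo-∷ʳ n) ⟨
    sum (map f (upTo n ++ n ∷ []))       ≡⟨ cong sum (map-++ f (upTo n) (n ∷ [])) ⟩
    sum (map f (upTo n) ++ f n ∷ [])     ≡⟨ sum-++ (map f (upTo n)) (f n ∷ []) ⟩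
    sum (map f (upTo n)) + (f n + 0)     ≡⟨ cong₂ _+_ (sum-map-upTo n f) (+-identityʳ (f n)) ⟩
    ∑ n f + f n                          ∎
    where open ≡-Reasoning

  count : ∀ k → ℕ → (Vec ℕ k → Bool) → ℕ
  count k n q = length (filterᵇ q (tuplesUpTo k n))

  count-zero : ∀ n (q : Vec ℕ 0 → Bool) → count 0 n q ≡ (if q [] then 1 else 0)
  count-zero n q with q []
  ... | true  = refl
  ... | false = refl

  count-suc : ∀ k n q → count (suc k) n q ≡ ∑[ x < suc n ] count k n (λ v → q (x ∷ v))
  count-suc k n q = begin
    count (suc k) n q
      ≡⟨ length-filterᵇ-concatMap q (λ x → map (x ∷_) (tuplesUpTo k n)) (upTo (suc n)) ⟩
    sum (map (λ x → length (filterᵇ q (map (x ∷_) (tuplesUpTo k n)))) (upTo (suc n)))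
      ≡⟨ cong sum (map-cong (λ x → length-filterᵇ-map q (x ∷_) (tuplesUpTo k n)) (upTo (suc n))) ⟩
    sum (map (λ x → count k n (λ v → q (x ∷ v))) (upTo (suc n)))         ≡⟨ sum-map-upTo (suc n) _ ⟩
    ∑[ x < suc n ] count k n (λ v → q (x ∷ v))                           ∎
    where open ≡-Reasoning

  count-cong : ∀ k n {q q' : Vec ℕ k → Bool} → (∀ {v} → All (_≤ n) v → q v ≡ q' v) →
    count k n q ≡ count k n q'
  count-cong zero    n {q} {q'} eq =
    trans (count-zero n q) (trans (cong (if_then 1 else 0) (eq [])) (sym (count-zero n q')))
  count-cong (suc k) n {q} {q'} eq = trans (count-suc k n q) (trans
    (∑-cong (suc n) (λ x< → count-cong k n (λ vs → eq (≤-pred x< ∷ vs))))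
    (sym (count-suc k n q')))

  T-injective : ∀ {x y} → (T x → T y) → (T y → T x) → x ≡ y
  T-injective {false} {false} _ _ = refl
  T-injective {false} {true}  _ g = ⊥-elim (g tt)
  T-injective {true}  {false} f _ = ⊥-elim (f tt)
  T-injective {true}  {true}  _ _ = refl

  ≡ᵇ-cong : ∀ {a b c d} → (a ≡ b → c ≡ d) → (c ≡ d → a ≡ b) → (a ≡ᵇ b) ≡ (c ≡ᵇ d)
  ≡ᵇ-cong {a} {b} {c} {d} f g =
    T-injective (≡⇒≡ᵇ c d ∘ f ∘ ≡ᵇ⇒≡ a b) (≡⇒≡ᵇ a b ∘ g ∘ ≡ᵇ⇒≡ c d)

  maxPile-≤ : ∀ {k n} {v : Vec ℕ k} → All (_≤ n) v → maxPile v ≤ n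
  maxPile-≤ []         = z≤n
  maxPile-≤ (x≤ ∷ v≤) = ⊔-lub x≤ (maxPile-≤ v≤)

  [x⊔y≡ᵇn]≡[y≡ᵇn] : ∀ {x y n} → x < n → y ≤ n → (x ⊔ y ≡ᵇ n) ≡ (y ≡ᵇ n)
  [x⊔y≡ᵇn]≡[y≡ᵇn] {x} {y} {n} x<n y≤n = ≡ᵇ-cong y≡n (λ y≡n → trans (cong (x ⊔_) y≡n) (m≤n⇒m⊔n≡n (<⇒≤ x<n)))
    where
    y≡n : x ⊔ y ≡ n → y ≡ n
    y≡n x⊔y≡n with y ≟ n
    ... | yes y≡n = y≡n
    ... | no  y≢n = ⊥-elim (<-irrefl x⊔y≡n (⊔-lub x<n (≤∧≢⇒< y≤n y≢n)))

  [n⊔y≡ᵇn]≡true : ∀ {n y} → y ≤ n → (n ⊔ y ≡ᵇ n) ≡ true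
  [n⊔y≡ᵇn]≡true {n} y≤n =
    trans (cong (_≡ᵇ n) (m≥n⇒m⊔n≡m y≤n)) (T-injective (λ _ → tt) (λ _ → ≡⇒≡ᵇ n n refl))

  count-maxPile : ∀ k n q →
    count k (suc n) (λ v → q v ∧ (maxPile v ≡ᵇ suc n)) + count k n q ≡ count k (suc n) q
  count-maxPile zero n q with q []
  ... | true  = refl
  ... | false = refl
  count-maxPile (suc k) n q = begin
    count (suc k) (suc n) P + count (suc k) n q   ≡⟨ cong₂ _+_ (count-suc k (suc n) P) (count-suc k n q) ⟩
    (∑ (suc n) A + A (suc n)) + ∑ (suc n) B       ≡⟨ swap (∑ (suc n) A) (A (suc n)) (∑ (suc n) B) ⟩
    (∑ (suc n) A + ∑ (suc n) B) + A (suc n)       ≡⟨ cong₂ _+_ (sym (∑-distrib-+ (suc n) A B)) top ⟩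
    ∑[ x < suc n ] (A x + B x) + C (suc n)        ≡⟨ cong (_+ C (suc n)) (∑-cong (suc n) below) ⟩
    ∑ (suc n) C + C (suc n)                       ≡⟨ count-suc k (suc n) q ⟨
    count (suc k) (suc n) q                       ∎
    where
    open ≡-Reasoning
    P : Vec ℕ (suc k) → Bool
    P v = q v ∧ (maxPile v ≡ᵇ suc n)
    A B C : ℕ → ℕ
    A x = count k (suc n) (λ v → q (x ∷ v) ∧ (x ⊔ maxPile v ≡ᵇ suc n))
    B x = count k n (λ v → q (x ∷ v))
    C x = count k (suc n) (λ v → q (x ∷ v))
    swap : ∀ a b c → (a + b) + c ≡ (a + c) + b
    swap = solve-∀
    top : A (suc n) ≡ C (suc n)
    top = count-cong k (suc n) (λ {v} v≤ →
      trans (cong (q (suc n ∷ v) ∧_) ([n⊔y≡ᵇn]≡true (maxPile-≤ v≤))) (∧-identityʳ _))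
    below : ∀ {x} → x < suc n → A x + B x ≡ C x
    below {x} x< = trans
      (cong (_+ B x) (count-cong k (suc n) λ {v} v≤ →
        cong (q (x ∷ v) ∧_) ([x⊔y≡ᵇn]≡[y≡ᵇn] x< (maxPile-≤ v≤))))
      (count-maxPile k n (λ v → q (x ∷ v)))

  -- Counting tuples by their xor

  -- xorCount f M j t is the number of j-tuples over [0, M) whose f-bit xor is t.
  xorCount : (f M j t : ℕ) → ℕ
  xorCount f M zero    zero    = 1
  xorCount f M zero    (suc _) = 0
  xorCount f M (suc j) t       = ∑[ x < M ] xorCount f M j (xorF f x t)

  nimSum-< : ∀ f {k n} {v : Vec ℕ k} → n < 2 ^ f → All (_≤ n) v → nimSum v < 2 ^ f
  nimSum-< f n< []        = m^n>0 2 f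
  nimSum-< f n< (x≤ ∷ v≤) = subst (_< 2 ^ f)
    (sym (⊕≡xorF f (≤-<-trans x≤ n<) (nimSum-< f n< v≤))) (xorF-< f _ _)

  count-nimSum≡ : ∀ f k n t → n < 2 ^ f → t < 2 ^ f →
    count k n (λ v → nimSum v ≡ᵇ t) ≡ xorCount f (suc n) k t
  count-nimSum≡ f zero    n zero    _  _  = refl
  count-nimSum≡ f zero    n (suc t) _  _  = refl
  count-nimSum≡ f (suc k) n t       n< t< =
    trans (count-suc k n (λ v → nimSum v ≡ᵇ t)) (∑-cong (suc n) λ {x} x< →
    trans (count-cong k n (λ v≤ → shift (≤-<-trans (≤-pred x<) n<) (nimSum-< f n< v≤)))
          (count-nimSum≡ f k n (xorF f x t) n< (xorF-< f x t)))
    where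
    shift : ∀ {x s} → x < 2 ^ f → s < 2 ^ f → (x ⊕ s ≡ᵇ t) ≡ (s ≡ᵇ xorF f x t)
    shift {x} {s} x< s< rewrite ⊕≡xorF f x< s< = ≡ᵇ-cong
      (λ e → trans (sym (xorF-involutive f x s<)) (cong (xorF f x) e))
      (λ e → trans (cong (xorF f x) e) (xorF-involutive f x t<))

  xorCount-zero-pos : ∀ f M {t} → 0 < t → xorCount f M 0 t ≡ 0
  xorCount-zero-pos f M {suc t} _ = refl

  ∑-xorCount-zero : ∀ f M {n} → 0 < n → ∑[ t < n ] xorCount f M 0 t ≡ 1
  ∑-xorCount-zero f M {suc zero}    _ = refl
  ∑-xorCount-zero f M {suc (suc n)} _ rewrite ∑-xorCount-zero f M {suc n} (s≤s z≤n) = refl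

  bit : Bool → ℕ
  bit false = 0
  bit true  = 1

  isEven : ℕ → Bool
  isEven zero    = true
  isEven (suc n) = not (isEven n)

  module TwoHalves (b c : ℕ) (c≤N : c ≤ 2 ^ b) where

    N M : ℕ
    N = 2 ^ b
    M = N + c

    E : ℕ → ℕ → ℕ
    E = xorCount (suc b) M

    halfTotal : Bool → ℕ → ℕ
    halfTotal h j = ∑[ l < N ] E j (bit h * N + l)

    E-suc : ∀ j h {l} → l < N → E (suc j) (bit h * N + l) ≡
      ∑[ y < N ] E j (bit h * N + xorF b y l) + ∑[ y < c ] E j (bit (not h) * N + xorF b y l)
    E-suc j h {l} l<N = trans (∑-+ N c _) (cong₂ _+_
      (∑-cong N λ {x} x<N → cong (E j)
        (trans (xorF-highBit b 0 (bit h) x<N l<N) (cong (λ z → z * N + xorF b x l) (lowSum h))))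
      (∑-cong c λ {y} y<c → cong (E j)
        (trans (cong (λ z → xorF (suc b) (z + y) (bit h * N + l)) (sym (*-identityˡ N)))
        (trans (xorF-highBit b 1 (bit h) (<-≤-trans y<c c≤N) l<N) (cong (λ z → z * N + xorF b y l) (highSum h))))))
      where
      lowSum : ∀ h → (0 + bit h) % 2 ≡ bit h
      lowSum false = refl
      lowSum true  = refl
      highSum : ∀ h → (1 + bit h) % 2 ≡ bit (not h)
      highSum false = refl
      highSum true  = refl

    ∑-E-xorF : ∀ j h y → ∑[ l < N ] E j (bit h * N + xorF b y l) ≡ halfTotal h j
    ∑-E-xorF j h y = ∑-xorF b y (λ z → E j (bit h * N + z))

    high-pos : ∀ l → 0 < 1 * N + l
    high-pos l = <-≤-trans (subst (0 <_) (sym (*-identityˡ N)) (m^n>0 2 b)) (m≤m+n (1 * N) l)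

    halfTotal-zero : ∀ h → halfTotal h 0 ≡ bit (not h)
    halfTotal-zero false = ∑-xorCount-zero (suc b) M (m^n>0 2 b)
    halfTotal-zero true  = trans (∑-cong N λ {l} _ → xorCount-zero-pos (suc b) M (high-pos l))
      (trans (∑-const N 0) (*-zeroʳ N))

    halfTotal-suc : ∀ h j → halfTotal h (suc j) ≡ N * halfTotal h j + c * halfTotal (not h) j
    halfTotal-suc h j = begin
      ∑[ l < N ] E (suc j) (bit h * N + l)
        ≡⟨ ∑-cong N (E-suc j h) ⟩
      ∑[ l < N ] (∑[ y < N ] E j (bit h * N + xorF b y l) + ∑[ y < c ] E j (bit (not h) * N + xorF b y l))
        ≡⟨ ∑-distrib-+ N _ _ ⟩
      ∑[ l < N ] ∑[ y < N ] E j (bit h * N + xorF b y l) + ∑[ l < N ] ∑[ y < c ] E j (bit (not h) * N + xorF b y l)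
        ≡⟨ cong₂ _+_ (∑-comm N N _) (∑-comm N c _) ⟩
      ∑[ y < N ] ∑[ l < N ] E j (bit h * N + xorF b y l) + ∑[ y < c ] ∑[ l < N ] E j (bit (not h) * N + xorF b y l)
        ≡⟨ cong₂ _+_ (∑-cong N λ {y} _ → ∑-E-xorF j h y) (∑-cong c λ {y} _ → ∑-E-xorF j (not h) y) ⟩
      ∑[ _ < N ] halfTotal h j + ∑[ _ < c ] halfTotal (not h) j
        ≡⟨ cong₂ _+_ (∑-const N _) (∑-const c _) ⟩
      N * halfTotal h j + c * halfTotal (not h) j ∎
      where open ≡-Reasoning

    -- If the top bit is isEven j, the number of high entries has the parity opposite to j, so some
    -- entry is low and the lower b bits of the xor are equidistributed.
    E-uniform : ∀ j h → isEven j ≡ h → ∀ {l} → l < N → N * E j (bit h * N + l) ≡ halfTotal h j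
    E-uniform zero    false ()
    E-uniform zero    true  _ {l} _ = begin
      N * E 0 (1 * N + l) ≡⟨ cong (N *_) (xorCount-zero-pos (suc b) M (high-pos l)) ⟩
      N * 0               ≡⟨ *-zeroʳ N ⟩
      0                   ≡⟨ halfTotal-zero true ⟨
      halfTotal true 0    ∎
      where open ≡-Reasoning
    E-uniform (suc j) h even {l} l<N = begin
      N * E (suc j) (bit h * N + l)
        ≡⟨ cong (N *_) (E-suc j h l<N) ⟩
      N * (∑[ y < N ] E j (bit h * N + xorF b y l) + ∑[ y < c ] E j (bit (not h) * N + xorF b y l))
        ≡⟨ *-distribˡ-+ N _ _ ⟩
      N * ∑[ y < N ] E j (bit h * N + xorF b y l) + N * ∑[ y < c ] E j (bit (not h) * N + xorF b y l)
        ≡⟨ cong₂ _+_ (cong (N *_) low) (sym (∑-distribˡ-* c N _)) ⟩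
      N * halfTotal h j + ∑[ y < c ] (N * E j (bit (not h) * N + xorF b y l))
        ≡⟨ cong (N * halfTotal h j +_) (∑-cong c λ {y} _ → E-uniform j (not h) even' (xorF-< b y l)) ⟩
      N * halfTotal h j + ∑[ _ < c ] halfTotal (not h) j
        ≡⟨ cong (N * halfTotal h j +_) (∑-const c _) ⟩
      N * halfTotal h j + c * halfTotal (not h) j
        ≡⟨ halfTotal-suc h j ⟨
      halfTotal h (suc j) ∎
      where
      open ≡-Reasoning
      even' : isEven j ≡ not h
      even' = trans (sym (not-involutive (isEven j))) (cong not even)
      low : ∑[ y < N ] E j (bit h * N + xorF b y l) ≡ halfTotal h j
      low = trans (∑-cong N λ {y} _ → cong (λ z → E j (bit h * N + z)) (xorF-comm b y l)) (∑-E-xorF j h l)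

    halfTotal-+ : ∀ j → halfTotal false j + halfTotal true j ≡ (N + c) ^ j
    halfTotal-+ zero    = cong₂ _+_ (halfTotal-zero false) (halfTotal-zero true)
    halfTotal-+ (suc j) = begin
      halfTotal false (suc j) + halfTotal true (suc j)
        ≡⟨ cong₂ _+_ (halfTotal-suc false j) (halfTotal-suc true j) ⟩
      (N * L + c * H) + (N * H + c * L)  ≡⟨ regroup N c L H ⟩
      (N + c) * (L + H)                  ≡⟨ cong ((N + c) *_) (halfTotal-+ j) ⟩
      (N + c) ^ suc j                    ∎
      where
      open ≡-Reasoning
      L = halfTotal false j
      H = halfTotal true j
      regroup : ∀ N c L H → (N * L + c * H) + (N * H + c * L) ≡ (N + c) * (L + H)
      regroup = solve-∀

    halfTotal-∸ : ∀ j → halfTotal false j ≡ halfTotal true j + (N ∸ c) ^ j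
    halfTotal-∸ zero    = trans (halfTotal-zero false) (cong (_+ 1) (sym (halfTotal-zero true)))
    halfTotal-∸ (suc j) = begin
      halfTotal false (suc j)              ≡⟨ halfTotal-suc false j ⟩
      N * L + c * H                        ≡⟨ cong (λ z → N * z + c * H) (halfTotal-∸ j) ⟩
      N * (H + D) + c * H                  ≡⟨ cong (λ z → z * (H + D) + c * H) N≡c+e ⟩
      (c + e) * (H + D) + c * H            ≡⟨ regroup c e H D ⟩
      ((c + e) * H + c * (H + D)) + e * D  ≡⟨ cong (λ z → (z * H + c * (H + D)) + e * D) N≡c+e ⟨
      (N * H + c * (H + D)) + e * D        ≡⟨ cong (λ z → (N * H + c * z) + e * D) (halfTotal-∸ j) ⟨
      (N * H + c * L) + e * D              ≡⟨ cong (_+ e * D) (halfTotal-suc true j) ⟨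
      halfTotal true (suc j) + (N ∸ c) ^ suc j ∎
      where
      open ≡-Reasoning
      L = halfTotal false j
      H = halfTotal true j
      e = N ∸ c
      D = e ^ j
      N≡c+e : N ≡ c + e
      N≡c+e = sym (m+[n∸m]≡n c≤N)
      regroup : ∀ c e H D → (c + e) * (H + D) + c * H ≡ ((c + e) * H + c * (H + D)) + e * D
      regroup = solve-∀

    2*halfTotal-false : ∀ j → 2 * halfTotal false j ≡ (N + c) ^ j + (N ∸ c) ^ j
    2*halfTotal-false j = begin
      L + (L + 0)                   ≡⟨ cong (L +_) (trans (+-identityʳ L) (halfTotal-∸ j)) ⟩
      L + (H + (N ∸ c) ^ j)         ≡⟨ +-assoc L H _ ⟨
      (L + H) + (N ∸ c) ^ j         ≡⟨ cong (_+ (N ∸ c) ^ j) (halfTotal-+ j) ⟩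
      (N + c) ^ j + (N ∸ c) ^ j     ∎
      where
      open ≡-Reasoning
      L = halfTotal false j
      H = halfTotal true j

    2N*E-odd : ∀ k → isEven k ≡ false → 2 * N * E k 0 ≡ (N + c) ^ k + (N ∸ c) ^ k
    2N*E-odd k odd = begin
      2 * N * E k 0        ≡⟨ *-assoc 2 N _ ⟩
      2 * (N * E k 0)      ≡⟨ cong (2 *_) (E-uniform k false odd (m^n>0 2 b)) ⟩
      2 * halfTotal false k ≡⟨ 2*halfTotal-false k ⟩
      (N + c) ^ k + (N ∸ c) ^ k ∎
      where open ≡-Reasoning

  %2≡1⇒isEven≡false : ∀ k → k % 2 ≡ 1 → isEven k ≡ false
  %2≡1⇒isEven≡false 1             _ = refl
  %2≡1⇒isEven≡false (suc (suc k)) e = trans (not-involutive (isEven k)) (%2≡1⇒isEven≡false k e)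

  d+xorCount : ∀ f k {n} → 0 < n → n < 2 ^ f → d k n + xorCount f n k 0 ≡ xorCount f (suc n) k 0
  d+xorCount f k {suc n} _ n< = begin
    d k (suc n) + xorCount f (suc n) k 0
      ≡⟨ cong (d k (suc n) +_) (count-nimSum≡ f k n 0 (<-trans (n<1+n n) n<) (m^n>0 2 f)) ⟨
    d k (suc n) + count k n zeroNimSum     ≡⟨ count-maxPile k n zeroNimSum ⟩
    count k (suc n) zeroNimSum             ≡⟨ count-nimSum≡ f k (suc n) 0 n< (m^n>0 2 f) ⟩
    xorCount f (suc (suc n)) k 0           ∎
    where
    open ≡-Reasoning
    zeroNimSum : Vec ℕ k → Bool
    zeroNimSum v = nimSum v ≡ᵇ 0

  d-powerSum : ∀ k → isEven k ≡ false → ∀ b c → c < 2 ^ b → let N = 2 ^ b in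
    2 * N * d k (N + c) + ((N + c) ^ k + (N ∸ c) ^ k) ≡ (N + suc c) ^ k + (N ∸ suc c) ^ k
  d-powerSum k odd b c c<N = begin
    2 * N * d k (N + c) + ((N + c) ^ k + (N ∸ c) ^ k)
      ≡⟨ cong (2 * N * d k (N + c) +_) (Low.2N*E-odd k odd) ⟨
    2 * N * d k (N + c) + 2 * N * Low.E k 0
      ≡⟨ *-distribˡ-+ (2 * N) _ _ ⟨
    2 * N * (d k (N + c) + Low.E k 0)
      ≡⟨ cong (2 * N *_) (d+xorCount (suc b) k 0<N+c N+c<2N) ⟩
    2 * N * xorCount (suc b) (suc (N + c)) k 0
      ≡⟨ cong (λ M → 2 * N * xorCount (suc b) M k 0) (+-suc N c) ⟨
    2 * N * High.E k 0
      ≡⟨ High.2N*E-odd k odd ⟩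
    (N + suc c) ^ k + (N ∸ suc c) ^ k ∎
    where
    open ≡-Reasoning
    N = 2 ^ b
    module Low  = TwoHalves b c (<⇒≤ c<N)
    module High = TwoHalves b (suc c) c<N
    0<N+c : 0 < N + c
    0<N+c = <-≤-trans (m^n>0 2 b) (m≤m+n N c)
    N+c<2N : N + c < 2 ^ suc b
    N+c<2N = +-monoʳ-< N (subst (c <_) (sym (+-identityʳ N)) c<N)

  -- Leading bit

  ⌊n/2⌋<m : ∀ {m} n → n < m + m → ⌊ n /2⌋ < m
  ⌊n/2⌋<m {suc m} 0             _  = z<s
  ⌊n/2⌋<m {suc m} 1             _  = z<s
  ⌊n/2⌋<m {suc m} (suc (suc n)) n< =
    s<s (⌊n/2⌋<m n (s<s⁻¹ (s<s⁻¹ (subst (suc (suc n) <_) (cong suc (+-suc m m)) n<))))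
  ⌊n/2⌋<m {zero} 0 ()

  ⌊log₂[2+n]⌋≡1+⌊log₂⌊[2+n]/2⌋⌋ : ∀ n → ⌊log₂ (2 + n) ⌋ ≡ suc ⌊log₂ ⌊ 2 + n /2⌋ ⌋
  ⌊log₂[2+n]⌋≡1+⌊log₂⌊[2+n]/2⌋⌋ n =
    trans (sym (m+[n∸m]≡n 1≤log)) (cong suc (sym (⌊log₂⌊n/2⌋⌋≡⌊log₂n⌋∸1 (2 + n))))
    where
    1≤log : 1 ≤ ⌊log₂ (2 + n) ⌋
    1≤log = subst (_≤ ⌊log₂ (2 + n) ⌋) (⌊log₂[2^n]⌋≡n 1) (⌊log₂⌋-mono-≤ {2} {2 + n} (s≤s (s≤s z≤n)))

  ⌊log₂n⌋≤m : ∀ m {n} → 0 < n → n < 2 ^ suc m → ⌊log₂ n ⌋ ≤ m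
  ⌊log₂n⌋≤m m       {1}           _ _  = subst (_≤ m) (sym (⌊log₂[2^n]⌋≡n 0)) z≤n
  ⌊log₂n⌋≤m (suc m) {suc (suc n)} _ n< = subst (_≤ suc m) (sym (⌊log₂[2+n]⌋≡1+⌊log₂⌊[2+n]/2⌋⌋ n))
    (s≤s (⌊log₂n⌋≤m m z<s (⌊n/2⌋<m (2 + n) (subst (2 + n <_) (cong (2 ^ suc m +_) (+-identityʳ _)) n<))))
  ⌊log₂n⌋≤m zero    {suc (suc n)} _ (s<s (s<s ()))

  2^⌊log₂n⌋≤n : ∀ {n} → 0 < n → 2 ^ ⌊log₂ n ⌋ ≤ n
  2^⌊log₂n⌋≤n {n} 0<n with ⌊log₂ n ⌋ in eq
  ... | zero  = 0<n
  ... | suc m = ≮⇒≥ λ n< → <-irrefl refl (subst (_≤ m) eq (⌊log₂n⌋≤m m 0<n n<))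

  n<2^suc⌊log₂n⌋ : ∀ n → n < 2 ^ suc ⌊log₂ n ⌋
  n<2^suc⌊log₂n⌋ n = ≰⇒> λ 2^≤n →
    <-irrefl refl (subst (_≤ ⌊log₂ n ⌋) (⌊log₂[2^n]⌋≡n (suc ⌊log₂ n ⌋)) (⌊log₂⌋-mono-≤ 2^≤n))

  n∸2^⌊log₂n⌋<2^⌊log₂n⌋ : ∀ {n} → 0 < n → n ∸ 2 ^ ⌊log₂ n ⌋ < 2 ^ ⌊log₂ n ⌋
  n∸2^⌊log₂n⌋<2^⌊log₂n⌋ {n} 0<n = +-cancelˡ-< N (n ∸ N) N
    (subst₂ _<_ (sym (m+[n∸m]≡n (2^⌊log₂n⌋≤n 0<n))) (cong (N +_) (+-identityʳ N)) (n<2^suc⌊log₂n⌋ n))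
    where
    N = 2 ^ ⌊log₂ n ⌋

module _ where

  open import Data.Bool using (false)
  open import Relation.Binary.PropositionalEquality
  open import Data.Nat as ℕ using (ℕ; zero; suc; _≤_; _<_)
  open import Data.Nat.Properties using (<⇒≤; +-comm)
  open import Data.Integer using (ℤ; +_; _+_; _-_; _*_; _^_)
  open import Data.Integer.Properties using (pos-+; pos-*; [+m]-[+n]≡m⊖n; ⊖-≥)
  open import Data.Integer.Tactic.RingSolver using (solve-∀)

  pos-^ : ∀ m e → (+ m) ^ e ≡ + (m ℕ.^ e)
  pos-^ m zero    = refl
  pos-^ m (suc e) = trans (cong ((+ m) *_) (pos-^ m e)) (sym (pos-* m (m ℕ.^ e)))

  pos-∸ : ∀ {m n} → n ≤ m → + m - + n ≡ + (m ℕ.∸ n)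
  pos-∸ {m} {n} n≤m = trans ([+m]-[+n]≡m⊖n m n) (⊖-≥ n≤m)

  pos-powerSum : ∀ k {N c} → c ≤ N →
    + ((N ℕ.+ c) ℕ.^ k ℕ.+ (N ℕ.∸ c) ℕ.^ k) ≡ (+ N + + c) ^ k + (+ N - + c) ^ k
  pos-powerSum k {N} {c} c≤N = begin
    + ((N ℕ.+ c) ℕ.^ k ℕ.+ (N ℕ.∸ c) ℕ.^ k)        ≡⟨ pos-+ ((N ℕ.+ c) ℕ.^ k) ((N ℕ.∸ c) ℕ.^ k) ⟩
    + ((N ℕ.+ c) ℕ.^ k) + + ((N ℕ.∸ c) ℕ.^ k)      ≡⟨ cong₂ _+_ (pos-^ (N ℕ.+ c) k) (pos-^ (N ℕ.∸ c) k) ⟨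
    (+ (N ℕ.+ c)) ^ k + (+ (N ℕ.∸ c)) ^ k          ≡⟨ cong (λ x → (+ (N ℕ.+ c)) ^ k + x ^ k) (pos-∸ c≤N) ⟨
    (+ N + + c) ^ k + (+ N - + c) ^ k              ∎
    where open ≡-Reasoning

  d-numerator : ℕ → ℤ → ℤ → ℤ
  d-numerator k B C = (((B + C) ^ k + (B - C) ^ k) - (B + C - + 1) ^ k) - (B - C + + 1) ^ k

  d-formula : ∀ k → isEven k ≡ false → ∀ b c → c < 2 ℕ.^ b →
    (+ 2) ^ (b ℕ.+ 1) * + d k (2 ℕ.^ b ℕ.+ c) ≡ d-numerator k ((+ 2) ^ b) (+ suc c)
  d-formula k odd b c c<N = begin
    (+ 2) ^ (b ℕ.+ 1) * + d k (N ℕ.+ c)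
      ≡⟨ cong (_* + d k (N ℕ.+ c)) (trans (pos-^ 2 (b ℕ.+ 1)) (cong (λ e → + (2 ℕ.^ e)) (+-comm b 1))) ⟩
    + (2 ℕ.* N) * + d k (N ℕ.+ c)                      ≡⟨ pos-* (2 ℕ.* N) (d k (N ℕ.+ c)) ⟨
    + X                                                ≡⟨ cancel (+ X) (+ Y) ⟩
    (+ X + + Y) - + Y
      ≡⟨ cong (_- + Y) (trans (sym (pos-+ X Y)) (cong +_ (d-powerSum k odd b c c<N))) ⟩
    + Z - + Y
      ≡⟨ cong₂ _-_ (pos-powerSum k c<N) (pos-powerSum k (<⇒≤ c<N)) ⟩
    ((B + C) ^ k + (B - C) ^ k) - ((B + + c) ^ k + (B - + c) ^ k)
      ≡⟨ cong₂ (λ u v → ((B + C) ^ k + (B - C) ^ k) - (u ^ k + v ^ k)) (below B (+ c)) (above B (+ c)) ⟩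
    ((B + C) ^ k + (B - C) ^ k) - ((B + C - + 1) ^ k + (B - C + + 1) ^ k)
      ≡⟨ reassoc ((B + C) ^ k + (B - C) ^ k) ((B + C - + 1) ^ k) ((B - C + + 1) ^ k) ⟩
    d-numerator k B C                                  ≡⟨ cong (λ x → d-numerator k x C) (pos-^ 2 b) ⟨
    d-numerator k ((+ 2) ^ b) C                        ∎
    where
    open ≡-Reasoning
    N = 2 ℕ.^ b
    B = + N
    C = + suc c
    X = 2 ℕ.* N ℕ.* d k (N ℕ.+ c)
    Y = (N ℕ.+ c) ℕ.^ k ℕ.+ (N ℕ.∸ c) ℕ.^ k
    Z = (N ℕ.+ suc c) ℕ.^ k ℕ.+ (N ℕ.∸ suc c) ℕ.^ k
    cancel : ∀ x y → x ≡ (x + y) - y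
    cancel = solve-∀
    below : ∀ B x → B + x ≡ B + (+ 1 + x) - + 1
    below = solve-∀
    above : ∀ B x → B - x ≡ B - (+ 1 + x) + + 1
    above = solve-∀
    reassoc : ∀ a u v → a - (u + v) ≡ (a - u) - v
    reassoc = solve-∀

open import Data.Nat using (ℕ; _<_; _∸_)
open import Data.Nat.DivMod using (_%_)
open import Data.Nat.Logarithm using (⌊log₂_⌋)
open import Data.Integer using (ℤ; +_; _-_; _^_) renaming (_+_ to _+ℤ_; _*_ to _*ℤ_)
open import Relation.Binary.PropositionalEquality using (_≡_; cong; sym; trans; module ≡-Reasoning)
open import Data.Nat.Properties using (m+[n∸m]≡n; +-∸-comm; +-comm)
open import Function using (_∘_)

theorem16 : (k : ℕ) → k % 2 ≡ 1 → (n : ℕ) → 0 < n →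
    let b = ⌊log₂ n ⌋
        B = (+ 2) ^ b
        c = + (n Data.Nat.+ 1 ∸ 2 Data.Nat.^ b)
    in (+ 2) ^ (b Data.Nat.+ 1) *ℤ (+ d k n)
         ≡ (((B +ℤ c) ^ k +ℤ (B - c) ^ k) - (B +ℤ c - + 1) ^ k) - (B - c +ℤ + 1) ^ k
theorem16 k k-odd n 0<n = begin
  (+ 2) ^ (b + 1) *ℤ + d k n
    ≡⟨ cong (λ m → (+ 2) ^ (b + 1) *ℤ + d k m) (sym (m+[n∸m]≡n N≤n)) ⟩
  (+ 2) ^ (b + 1) *ℤ + d k (N + c)
    ≡⟨ d-formula k (%2≡1⇒isEven≡false k k-odd) b c (n∸2^⌊log₂n⌋<2^⌊log₂n⌋ 0<n) ⟩
  d-numerator k ((+ 2) ^ b) (+ suc c)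
    ≡⟨ cong (d-numerator k ((+ 2) ^ b) ∘ +_) (trans (+-∸-comm 1 N≤n) (+-comm c 1)) ⟨
  d-numerator k ((+ 2) ^ b) (+ (n + 1 ∸ N)) ∎
  where
  open ≡-Reasoning
  open Data.Nat using (_+_; suc)
  b = ⌊log₂ n ⌋
  N = 2 Data.Nat.^ b
  c = n ∸ N
  N≤n = 2^⌊log₂n⌋≤n 0<n
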